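{- (a) For all $n\in\omega$ and $i<n$, $t_n(i)<n-i$. (b) The map $M$ defined on $\{s_{t_n(i)}10^\infty : n\in\omega,\ i<n\}\subseteq 2^\omega$ by $M(\alpha):=\max\{p\in\omega:\alpha(p)=1\}$ is one-to-one.
   Context: The sequence $(t_n)$ in $\omega^{<\omega}$: with $(p_n)$ the primes in increasing order, $I(\emptyset):=1$, $I(s):=p_0^{s(0)+1}\cdots p_{|s|-1}^{s(|s|-1)+1}$ for $s\neq\emptyset$, $i$ the increasing bijection $I[\omega^{<\omega}]\to\omega$, $\psi:=(i\circ I)^{ -1}$ (so $|\psi(n)|\leq n$), and $t_n:=\psi(n)0^{n-|\psi(n)|}$. The sequence $(s_n)$ in $2^{<\omega}$: $\phi:\omega\to 2^{<\omega}$ is the natural enumeration by increasing length ($\phi(0)=\emptyset$, $\phi(1)=\langle0\rangle$, $\phi(2)=\langle1\rangle$, ...), and $s_n:=\phi(n)0^{n-|\phi(n)|}$, so $|s_n|=n$. $s10^\infty$ denotes the infinite sequence $s$ followed by $1$ and then zeros. -}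

module Defs where

open import Data.Nat using (ℕ; zero; suc; _+_; _*_; _∸_; _^_; _≤_; _<_; _!; _/_; _%_)
open import Data.Nat.Primality using (prime?)
open import Data.Nat using (_≟_; _<?_)
open import Data.List using (List; []; _∷_; _++_; [_]; length; replicate)
open import Data.Product using (Σ; ∃; _×_)
open import Data.Fin using (Fin)
open import Function.Bundles using (_↔_)
open import Relation.Nullary using (yes; no)
open import Relation.Binary.PropositionalEquality using (_≡_)

-- first prime in [start, start + fuel), or start + fuel if there is none
searchPrime : ℕ → ℕ → ℕ
searchPrime start zero = start
searchPrime start (suc fuel) with prime? start
... | yes _ = start
... | no  _ = searchPrime (suc start) fuel

-- least prime > m (by Euclid there is one in (m, m! + 1])
nextPrime : ℕ → ℕ
nextPrime m = searchPrime (suc m) (suc (m !))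

p : ℕ → ℕ
p zero    = 2
p (suc k) = nextPrime (p k)

I' : ℕ → List ℕ → ℕ
I' j []       = 1
I' j (x ∷ xs) = p j ^ suc x * I' (suc j) xs

I : List ℕ → ℕ
I = I' 0

-- ψ(n) = s  iff  i(I(s)) = n, i.e. exactly n elements of ω^{<ω} have a smaller code
PsiIs : ℕ → List ℕ → Set
PsiIs n s = Fin n ↔ Σ (List ℕ) (λ s' → I s' < I s)

at : List ℕ → ℕ → ℕ
at []       _       = 0
at (x ∷ xs) zero    = x
at (x ∷ xs) (suc i) = at xs i

-- t_n(i) where ψ(n) = s :  t_n = s 0^{n-|s|}
tval : List ℕ → ℕ → ℕ
tval s i = at s i

-- φ : ω → 2^{<ω}, enumeration by increasing length then lexicographically
-- (φ(2k+1) = φ(k)0, φ(2k+2) = φ(k)1); bits are 0/1 naturals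
phiF : ℕ → ℕ → List ℕ
phiF zero     _       = []
phiF (suc f)  zero    = []
phiF (suc f)  (suc n) = phiF f (n / 2) ++ [ n % 2 ]

phi : ℕ → List ℕ
phi n = phiF n n

sSeq : ℕ → List ℕ
sSeq n = phi n ++ replicate (n ∸ length (phi n)) 0

-- u 1 0^∞ as an element of 2^ω (bits as naturals)
seq10 : List ℕ → ℕ → ℕ
seq10 []       zero    = 1
seq10 []       (suc q) = 0
seq10 (x ∷ xs) zero    = x
seq10 (x ∷ xs) (suc q) = seq10 xs q

InSet : (ℕ → ℕ) → Set
InSet α = Σ ℕ λ n → Σ ℕ λ i → Σ (List ℕ) λ s →
  i < n × PsiIs n s × (∀ q → α q ≡ seq10 (sSeq (tval s i)) q)

IsMax : (ℕ → ℕ) → ℕ → Set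
IsMax α m = α m ≡ 1 × (∀ q → α q ≡ 1 → q ≤ m)

module Submission where

open import Defs
open import Data.Nat using (ℕ; _<_; _∸_)
open import Data.List using (List)
open import Data.Product using (Σ; _×_)
open import Relation.Binary.PropositionalEquality using (_≡_)

open import Data.Nat using (zero; suc; _+_; _^_; _≤_; z≤n; s≤s; _<?_; NonZero; >-nonZero; >-nonZero⁻¹)
open import Data.Nat.Properties
open import Data.Nat.Primality using (prime?)
open import Data.List using ([]; _∷_; [_]; length; replicate)
open import Data.List.Properties using (length-++; length-replicate; ∷-injectiveˡ; ∷-injectiveʳ)
open import Data.Product using (_,_; proj₁)
open import Data.Fin using (Fin; toℕ)
import Data.Fin as Fin
open import Data.Fin.Properties using (injective⇒≤; toℕ<n; toℕ-injective)
open import Function.Base using (_∘_)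
open import Function.Bundles using (_↔_; Injection)
open import Function.Definitions using (Injective)
open import Function.Properties.Inverse using (↔-sym; ↔⇒↣)
open import Relation.Nullary using (yes; no)
open import Relation.Binary.PropositionalEquality using (refl; sym; trans; cong; subst; _≗_; module ≡-Reasoning)

-- Write s = ψ(n), so that exactly n sequences have a code
-- I(s') < I(s).  If i ≥ |s| then t_n(i) = 0 < n - i.  Otherwise the
-- i + 1 + s(i) sequences
--     s|0, s|1, …, s|i   and   (s|i)c  for c < s(i)
-- are pairwise distinct and all have codes smaller than I(s) (a proper
-- prefix drops prime factors; (s|i)c lowers the exponent at position i
-- and drops the later factors).  Hence i + 1 + s(i) ≤ n, i.e. s(i) < n - i.
--
-- Part (b).  α = s_k 1 0^∞ has its last 1 at position |s_k| = k, so
-- M(α) exists and determines k; two members of the set with the same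
-- maximum are therefore both equal to s_k 1 0^∞ for the same k.

-- Every prime p k is at least 2: the search for the next prime only
-- moves upwards from a starting point ≥ 2.
searchPrime-≥ : ∀ start fuel → start ≤ searchPrime start fuel
searchPrime-≥ start zero = ≤-refl
searchPrime-≥ start (suc fuel) with prime? start
... | yes _ = ≤-refl
... | no  _ = ≤-trans (n≤1+n start) (searchPrime-≥ (suc start) fuel)

p-≥2 : ∀ k → 2 ≤ p k
p-≥2 zero    = ≤-refl
p-≥2 (suc k) = ≤-trans (p-≥2 k) (≤-trans (n≤1+n (p k)) (searchPrime-≥ (suc (p k)) _))

p-nonZero : ∀ j → NonZero (p j)
p-nonZero j = >-nonZero (≤-trans (s≤s z≤n) (p-≥2 j))

p^-nonZero : ∀ j e → NonZero (p j ^ e)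
p^-nonZero j e = >-nonZero (m^n>0 (p j) {{p-nonZero j}} e)

I'-nonZero : ∀ j s → NonZero (I' j s)
I'-nonZero j []       = _
I'-nonZero j (x ∷ xs) =
  >-nonZero (*-mono-≤ (m^n>0 (p j) {{p-nonZero j}} (suc x)) (>-nonZero⁻¹ _ {{I'-nonZero (suc j) xs}}))

below-head : ∀ {y} j x xs → y < p j ^ suc x → y < I' j (x ∷ xs)
below-head j x xs y< = ≤-trans y< (m≤m*n (p j ^ suc x) (I' (suc j) xs) {{I'-nonZero (suc j) xs}})

I'-nil< : ∀ j x xs → I' j [] < I' j (x ∷ xs)
I'-nil< j x xs = below-head j x xs (≤-trans (p-≥2 j) (m≤m*n (p j) (p j ^ x) {{p^-nonZero j x}}))

I'-single< : ∀ j {c} x xs → c < x → I' j [ c ] < I' j (x ∷ xs)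
I'-single< j {c} x xs c<x =
  below-head j x xs (subst (_< p j ^ suc x) (sym (*-identityʳ _)) (^-monoʳ-< (p j) (p-≥2 j) (s≤s c<x)))

I'-cons< : ∀ j x xs ys → I' (suc j) xs < I' (suc j) ys → I' j (x ∷ xs) < I' j (x ∷ ys)
I'-cons< j x xs ys lt = *-monoʳ-< (p j ^ suc x) {{p^-nonZero j (suc x)}} lt

SmallerCodes : ℕ → ℕ → List ℕ → Set
SmallerCodes k j s = Σ (Fin k → List ℕ) λ f → Injective _≡_ _≡_ f × (∀ c → I' j (f c) < I' j s)

smallerCodes : ∀ j s i → i < length s → SmallerCodes (i + suc (at s i)) j s
smallerCodes j (x ∷ xs) zero _ = f , f-injective , f-smaller
  where
  f : Fin (suc x) → List ℕ
  f Fin.zero    = []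
  f (Fin.suc c) = [ toℕ c ]
  f-injective : Injective _≡_ _≡_ f
  f-injective {Fin.zero}  {Fin.zero}  _ = refl
  f-injective {Fin.suc a} {Fin.suc b} e = cong Fin.suc (toℕ-injective (∷-injectiveˡ e))
  f-smaller : ∀ c → I' j (f c) < I' j (x ∷ xs)
  f-smaller Fin.zero    = I'-nil< j x xs
  f-smaller (Fin.suc c) = I'-single< j x xs (toℕ<n c)
smallerCodes j (x ∷ xs) (suc i) (s≤s i<) with smallerCodes (suc j) xs i i<
... | g , g-injective , g-smaller = f , f-injective , f-smaller
  where
  f : Fin (suc (i + suc (at xs i))) → List ℕ
  f Fin.zero    = []
  f (Fin.suc c) = x ∷ g c
  f-injective : Injective _≡_ _≡_ f
  f-injective {Fin.zero}  {Fin.zero}  _ = refl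
  f-injective {Fin.suc a} {Fin.suc b} e = cong Fin.suc (g-injective (∷-injectiveʳ e))
  f-smaller : ∀ c → I' j (f c) < I' j (x ∷ xs)
  f-smaller Fin.zero    = I'-nil< j x xs
  f-smaller (Fin.suc c) = I'-cons< j x (g c) xs (g-smaller c)

injection-bound : ∀ {k n} {B : Set} → Fin n ↔ B → (g : Fin k → B) → Injective _≡_ _≡_ g → k ≤ n
injection-bound e g g-injective =
  injective⇒≤ (g-injective ∘ Injection.injective (↔⇒↣ (↔-sym e)))

smallerCodes-bound : ∀ {n k} s → PsiIs n s → SmallerCodes k 0 s → k ≤ n
smallerCodes-bound s ψn=s (f , f-injective , f-smaller) =
  injection-bound ψn=s (λ c → f c , f-smaller c) (f-injective ∘ cong proj₁)

at-beyond : ∀ s i → length s ≤ i → at s i ≡ 0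
at-beyond []      i       _       = refl
at-beyond (x ∷ s) (suc i) (s≤s h) = at-beyond s i h

part-a : (n : ℕ) → (s : List ℕ) → PsiIs n s → (i : ℕ) → i < n → tval s i < n ∸ i
part-a n s ψn=s i i<n with i <? length s
... | no  i≮|s| rewrite at-beyond s i (≮⇒≥ i≮|s|) = m<n⇒0<n∸m i<n
... | yes i<|s| = m+n≤o⇒m≤o∸n (suc (at s i)) (subst (_≤ n) (+-comm i _) bound)
  where
  bound : i + suc (at s i) ≤ n
  bound = smallerCodes-bound s ψn=s (smallerCodes 0 s i i<|s|)

-- φ(n) has length at most n, so padding s_n to length n is exact.
phiF-length : ∀ f n → length (phiF f n) ≤ f
phiF-length zero    n       = z≤n
phiF-length (suc f) zero    = z≤n
phiF-length (suc f) (suc n) =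
  subst (_≤ suc f) (sym (trans (length-++ (phiF f _)) (+-comm _ 1))) (s≤s (phiF-length f _))

sSeq-length : ∀ k → length (sSeq k) ≡ k
sSeq-length k = begin
  length (sSeq k)                                  ≡⟨ length-++ (phi k) ⟩
  length (phi k) + length (replicate (k ∸ length (phi k)) 0)
                                                   ≡⟨ cong (length (phi k) +_) (length-replicate _) ⟩
  length (phi k) + (k ∸ length (phi k))            ≡⟨ m+[n∸m]≡n (phiF-length k k) ⟩
  k                                                ∎
  where open ≡-Reasoning

seq10-one : ∀ u → seq10 u (length u) ≡ 1
seq10-one []      = refl
seq10-one (x ∷ u) = seq10-one u

seq10-ones-≤ : ∀ u q → seq10 u q ≡ 1 → q ≤ length u
seq10-ones-≤ []      zero    _ = z≤n
seq10-ones-≤ (x ∷ u) zero    _ = z≤n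
seq10-ones-≤ (x ∷ u) (suc q) e = s≤s (seq10-ones-≤ u q e)

seq10-max : ∀ u → IsMax (seq10 u) (length u)
seq10-max u = seq10-one u , seq10-ones-≤ u

IsMax-resp : ∀ {α β m} → α ≗ β → IsMax β m → IsMax α m
IsMax-resp α≗β (βm=1 , β-bound) = trans (α≗β _) βm=1 , λ q αq=1 → β-bound q (trans (sym (α≗β q)) αq=1)

IsMax-unique : ∀ {α m m'} → IsMax α m → IsMax α m' → m ≡ m'
IsMax-unique (αm=1 , bound) (αm'=1 , bound') = ≤-antisym (bound' _ αm=1) (bound _ αm'=1)

member-max : ∀ {α} → InSet α → Σ ℕ λ k → (α ≗ seq10 (sSeq k)) × IsMax α k
member-max (_ , i , s , _ , _ , α≗) =
  tval s i , α≗ , IsMax-resp α≗ (subst (IsMax (seq10 (sSeq k))) (sSeq-length k) (seq10-max (sSeq k)))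
  where k = tval s i

M-injective : (α β : ℕ → ℕ) → InSet α → InSet β → (m : ℕ) → IsMax α m → IsMax β m → (q : ℕ) → α q ≡ β q
M-injective α β α∈ β∈ m αm βm q with member-max α∈ | member-max β∈
... | k , α≗ , αk | k' , β≗ , βk'
  rewrite IsMax-unique αk αm | IsMax-unique βk' βm = trans (α≗ q) (sym (β≗ q))

lemma4p5 : ((n : ℕ) → (s : List ℕ) → PsiIs n s → (i : ℕ) → i < n → tval s i < n ∸ i)
    × (((α : ℕ → ℕ) → InSet α → Σ ℕ (λ m → IsMax α m))
    × ((α β : ℕ → ℕ) → InSet α → InSet β → (m : ℕ) → IsMax α m → IsMax β m → (q : ℕ) → α q ≡ β q))
lemma4p5 = part-a , (λ α α∈ → let k , _ , αk = member-max α∈ in k , αk) , M-injective
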